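{- Let $S$ be a tree, $T$ a search tree on $S$, and $k\ge 2$. One can find a $k$-cut search tree $T^*$ on $S$ such that $\mathrm{depth}_{T^*}(x)\le(1+\varepsilon_k)\cdot\mathrm{depth}_T(x)$ for all $x\in V(S)$, where $\varepsilon_k=\frac{1}{\lfloor k/2\rfloor}$.
   Context: A search tree on an unrooted tree $S$ (STT) is a rooted tree $T$ with $V(T)=V(S)$ defined recursively: the root $r$ is any node of $S$, and the subtrees of $T$ rooted at the children of $r$ are search trees on the connected components of $S\setminus r$. $T_x$ is the subtree of $T$ rooted at $x$; $\mathrm{depth}_T(x)$ is the number of nodes on the root-to-$x$ path in $T$. For $A\subseteq V(S)$, $\delta_S(A)$ is the set of nodes outside $A$ adjacent in $S$ to some node of $A$. $T$ is a $k$-cut tree if $|\delta_S(V(T_x))|\le k$ for all $x\in V(S)$. -}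

module Defs where

open import Data.Nat using (ℕ; zero; suc; _+_; _*_; _≤_; _/_)
open import Data.Fin using (Fin)
open import Data.List using (List; []; _∷_; length; lookup; _++_; [_])
open import Data.List.Membership.Propositional using (_∈_)
open import Data.List.Relation.Unary.Unique.Propositional using (Unique)
open import Data.List.Relation.Unary.Linked using (Linked)
open import Data.Product using (Σ; ∃; _×_; _,_)
open import Data.Unit using (⊤)
open import Relation.Nullary using (¬_)
open import Relation.Binary.PropositionalEquality using (_≡_; _≢_)
open import Function.Bundles using (_⇔_)

Graph : ℕ → Set₁
Graph n = Fin n → Fin n → Set

VSet : ℕ → Set₁
VSet n = Fin n → Set

module _ {n : ℕ} (Adj : Graph n) where

  -- walks staying inside U (after the start vertex)
  data Reach (U : VSet n) : Fin n → Fin n → Set where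
    here : ∀ {x} → Reach U x x
    step : ∀ {x y z} → Adj x y → U y → Reach U y z → Reach U x z

  Cycle : Set
  Cycle = Σ (Fin n) λ v → Σ (List (Fin n)) λ ws →
            2 ≤ length ws × Unique (v ∷ ws) × Linked Adj (v ∷ (ws ++ [ v ]))

  record IsTree : Set where
    field
      sym     : ∀ {x y} → Adj x y → Adj y x
      irrefl  : ∀ {x} → ¬ Adj x x
      connected : ∀ x y → Reach (λ _ → ⊤) x y
      acyclic : ¬ Cycle

  -- W is a connected component of the subgraph of S induced by U
  IsComponent : VSet n → VSet n → Set
  IsComponent U W = (∃ λ x → W x) ×
                    (∀ x y → W x → (W y ⇔ (U y × Reach U x y)))

  Boundary : VSet n → VSet n
  Boundary A y = ¬ A y × (∃ λ a → A a × Adj a y)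

data RTree (n : ℕ) : Set where
  node : Fin n → List (RTree n) → RTree n

data _∈T_ {n : ℕ} (x : Fin n) : RTree n → Set where
  root  : ∀ {cs} → x ∈T node x cs
  child : ∀ {r c cs} → c ∈ cs → x ∈T c → x ∈T node r cs

VT : ∀ {n} → RTree n → VSet n
VT t x = x ∈T t

-- depth_T(x) = d : number of nodes on the root-to-x path
data Depth {n : ℕ} (x : Fin n) : RTree n → ℕ → Set where
  root  : ∀ {cs} → Depth x (node x cs) 1
  child : ∀ {r c cs d} → c ∈ cs → Depth x c d → Depth x (node r cs) (suc d)

data SubT {n : ℕ} (t : RTree n) : RTree n → Set where
  self  : SubT t t
  child : ∀ {r c cs} → c ∈ cs → SubT t c → SubT t (node r cs)

module _ {n : ℕ} (Adj : Graph n) where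

  data IsSTTOn (U : VSet n) : RTree n → Set where
    mk : ∀ {r cs} →
         U r →
         (∀ i j x → x ∈T lookup cs i → x ∈T lookup cs j → i ≡ j) →
         (∀ c → c ∈ cs → IsComponent Adj (λ x → U x × x ≢ r) (VT c)) →
         (∀ x → U x → x ≢ r → ∃ λ c → c ∈ cs × x ∈T c) →
         (∀ c → c ∈ cs → IsSTTOn (VT c) c) →
         IsSTTOn U (node r cs)

  IsSTT : RTree n → Set
  IsSTT = IsSTTOn (λ _ → ⊤)

  CardBoundary≤ : VSet n → ℕ → Set
  CardBoundary≤ A k = Σ (List (Fin n)) λ L → length L ≤ k ×
                        (∀ y → Boundary Adj A y → y ∈ L)

  IsKCut : ℕ → RTree n → Set
  IsKCut k T = ∀ t → SubT t T → CardBoundary≤ (VT t) k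

module Submission where

-- T* is built top-down, one connected vertex set U at a time. With U we carry a list L ⊇ δ(U) of
-- at most k vertices, the T*-depth D above U and a bound a below the T-depths of all of U, subject
-- to m·D + |L| ≤ (m+1)·a + 1 where m = ⌊k/2⌋; as the root v of U has depth_T v > a, this gives
-- m·(D+1) ≤ (m+1)·depth_T v. Let r be the T-shallowest vertex of U. If |L| < k, r becomes the root
-- and the components of U ∖ r lie below r in T. Otherwise the root is a separator c: every
-- component of U ∖ c avoiding r is adjacent to at most m vertices of L and lies below r in T,
-- while the component containing r keeps at most |L| − m − 1 of them, which pays for the extra
-- level. In all cases the boundary of a component is contained in {c} ∪ L, of size at most k.

open import Defs
open import Data.Nat using (ℕ; zero; suc; _+_; _*_; _≤_; _<_; z≤n; s≤s; z<s; _/_)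
open import Data.Nat.DivMod using (m/n<m)
import Data.Nat.Properties as ℕ
open import Data.Nat.Tactic.RingSolver using (solve)
open import Data.Fin as Fin using (Fin; toℕ)
open import Data.Fin.Properties using (_≟_; _<?_; <-cmp; any?; all?; injective⇒≤)
open import Data.Nat.Induction using (<-wellFounded)
open import Data.List using (List; []; _∷_; length; lookup; _++_; [_]; filter; allFin)
open import Data.List.Membership.Propositional using (_∈_)
open import Data.List.Membership.Propositional.Properties using (∈-lookup; ∈-allFin; ∈-filter⁺)
open import Data.List.Properties using (length-filter; filter-none)
open import Data.List.Relation.Unary.Any using (here; there)
import Data.List.Relation.Unary.Any as Any
open import Data.List.Relation.Unary.Any.Properties using (lookup-index)
open import Data.List.Relation.Unary.All using (All)
import Data.List.Relation.Unary.All as All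
open import Data.List.Relation.Unary.All.Properties using (¬Any⇒All¬; all-filter)
import Data.List.Relation.Unary.AllPairs as AllPairs
open import Data.List.Relation.Unary.Unique.Propositional using (Unique)
import Data.List.Relation.Unary.Unique.Propositional.Properties as Unique
open import Data.List.Relation.Unary.Linked using (Linked)
open import Data.Product using (Σ; ∃; _×_; _,_; proj₁; proj₂)
open import Data.Sum using (_⊎_; inj₁; inj₂)
open import Data.Unit using (tt)
open import Induction.WellFounded using (Acc; acc)
open import Relation.Binary.Definitions using (tri<; tri≈; tri>)
open import Relation.Nullary using (¬_; Dec; yes; no; contradiction)
open import Relation.Nullary.Decidable using (_×-dec_; _→-dec_; ¬?)
open import Relation.Unary using (Pred; Decidable; _⊆_; _≐_)
open import Relation.Binary.PropositionalEquality using (_≡_; _≢_; refl; sym; trans; cong; subst; subst₂)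
open import Function.Bundles using (mk⇔; Equivalence)

count : ∀ {a p} {A : Set a} {P : Pred A p} → Decidable P → List A → ℕ
count P? xs = length (filter P? xs)

module _ {a p q} {A : Set a} {P : Pred A p} {Q : Pred A q}
         (P? : Decidable P) (Q? : Decidable Q) where

  count-mono : P ⊆ Q → ∀ xs → count P? xs ≤ count Q? xs
  count-mono P⊆Q [] = z≤n
  count-mono P⊆Q (x ∷ xs) with P? x | Q? x
  ... | yes _  | yes _  = s≤s (count-mono P⊆Q xs)
  ... | yes px | no ¬qx = contradiction (P⊆Q px) ¬qx
  ... | no _   | yes _  = ℕ.m≤n⇒m≤1+n (count-mono P⊆Q xs)
  ... | no _   | no _   = count-mono P⊆Q xs

  count-< : P ⊆ Q → ∀ {x} xs → x ∈ xs → Q x → ¬ P x → count P? xs < count Q? xs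
  count-< P⊆Q (x ∷ xs) (here refl) qx ¬px with P? x | Q? x
  ... | yes px | _      = contradiction px ¬px
  ... | no _   | yes _  = s≤s (count-mono P⊆Q xs)
  ... | no _   | no ¬qx = contradiction qx ¬qx
  count-< P⊆Q (y ∷ xs) (there x∈xs) qx ¬px with P? y | Q? y
  ... | yes _  | yes _  = s≤s (count-< P⊆Q xs x∈xs qx ¬px)
  ... | yes py | no ¬qy = contradiction (P⊆Q py) ¬qy
  ... | no _   | yes _  = ℕ.m≤n⇒m≤1+n (count-< P⊆Q xs x∈xs qx ¬px)
  ... | no _   | no _   = count-< P⊆Q xs x∈xs qx ¬px

  count-disjoint : (∀ {x} → P x → ¬ Q x) → ∀ xs → count P? xs + count Q? xs ≤ length xs
  count-disjoint P∩Q=∅ [] = z≤n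
  count-disjoint P∩Q=∅ (x ∷ xs) with P? x | Q? x
  ... | yes px | yes qx = contradiction qx (P∩Q=∅ px)
  ... | yes _  | no _   = s≤s (count-disjoint P∩Q=∅ xs)
  ... | no _   | yes _  = subst (_≤ suc (length xs)) (sym (ℕ.+-suc _ _)) (s≤s (count-disjoint P∩Q=∅ xs))
  ... | no _   | no _   = ℕ.m≤n⇒m≤1+n (count-disjoint P∩Q=∅ xs)

lookup-injective : ∀ {a} {A : Set a} {xs : List A} → Unique xs →
                   ∀ i j → lookup xs i ≡ lookup xs j → i ≡ j
lookup-injective (_ AllPairs.∷ _)      Fin.zero    Fin.zero    _  = refl
lookup-injective (x∉xs AllPairs.∷ _)  Fin.zero    (Fin.suc j) eq =
  contradiction eq (All.lookup x∉xs (∈-lookup j))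
lookup-injective (x∉xs AllPairs.∷ _)  (Fin.suc i) Fin.zero    eq =
  contradiction (sym eq) (All.lookup x∉xs (∈-lookup i))
lookup-injective (_ AllPairs.∷ xs!)   (Fin.suc i) (Fin.suc j) eq = cong Fin.suc (lookup-injective xs! i j eq)

Unique⇒length≤ : ∀ {n} {xs : List (Fin n)} → Unique xs → length xs ≤ n
Unique⇒length≤ {xs = xs} xs! =
  injective⇒≤ {f = lookup xs} (λ {i} {j} → lookup-injective xs! i j)

module _ {n p} {P : Pred (Fin n) p} (P? : Decidable P) where

  minimal : ∀ {y} → P y → Σ (Fin n) λ x → P x × (∀ {z} → P z → x Fin.≤ z)
  minimal {y} = search y (<-wellFounded (toℕ y))
    where
    search : ∀ y → Acc _<_ (toℕ y) → P y → Σ (Fin n) λ x → P x × (∀ {z} → P z → x Fin.≤ z)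
    search y (acc smaller) py with any? (λ z → P? z ×-dec z <? y)
    ... | yes (z , pz , z<y) = search z (smaller z<y) pz
    ... | no none = y , py , λ pz → ℕ.≮⇒≥ (λ z<y → none (_ , pz , z<y))

record Invariant (m D ℓ a : ℕ) : Set where
  constructor invariant
  field bound : m * D + ℓ ≤ (m + 1) * a + 1

Invariant-start : ∀ m → Invariant m 0 0 0
Invariant-start m =
  invariant (subst₂ (λ x y → x + 0 ≤ y + 1) (sym (ℕ.*-zeroʳ m)) (sym (ℕ.*-zeroʳ (m + 1))) z≤n)

module _ {m D ℓ a : ℕ} (inv : Invariant m D ℓ a) where
  open ℕ.≤-Reasoning
  open Invariant inv

  Invariant-descend : ∀ {ℓ′ d} → ℓ′ ≤ ℓ → a < d → Invariant m (suc D) (suc ℓ′) d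
  Invariant-descend {ℓ′} {d} ℓ′≤ℓ a<d = invariant (begin
    m * suc D + suc ℓ′        ≤⟨ ℕ.+-monoʳ-≤ (m * suc D) (s≤s ℓ′≤ℓ) ⟩
    m * suc D + suc ℓ         ≡⟨ solve (m ∷ D ∷ ℓ ∷ []) ⟩
    (m * D + ℓ) + suc m       ≤⟨ ℕ.+-monoˡ-≤ (suc m) bound ⟩
    (m + 1) * a + 1 + suc m   ≡⟨ solve (m ∷ a ∷ []) ⟩
    (m + 1) * suc a + 1       ≤⟨ ℕ.+-monoˡ-≤ 1 (ℕ.*-monoʳ-≤ (m + 1) a<d) ⟩
    (m + 1) * d + 1           ∎)

  Invariant-root : ∀ {d} → a < d → m * (D + 1) ≤ (m + 1) * d
  Invariant-root {d} a<d = ℕ.+-cancelʳ-≤ 1 _ _ (begin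
    m * (D + 1) + 1   ≡⟨ cong (λ e → m * e + 1) (ℕ.+-comm D 1) ⟩
    m * suc D + 1     ≤⟨ Invariant.bound (Invariant-descend z≤n a<d) ⟩
    (m + 1) * d + 1   ∎)

  Invariant-shrink : ∀ {c} → c + suc m ≤ ℓ → Invariant m (suc D) (suc c) a
  Invariant-shrink {c} c+m<ℓ = invariant (begin
    m * suc D + suc c     ≡⟨ solve (m ∷ D ∷ c ∷ []) ⟩
    m * D + (c + suc m)   ≤⟨ ℕ.+-monoʳ-≤ (m * D) c+m<ℓ ⟩
    m * D + ℓ             ≤⟨ bound ⟩
    (m + 1) * a + 1       ∎)

module Walks {n : ℕ} (Adj : Graph n) where
  open import Data.List.Relation.Unary.All using ([]; _∷_)
  open import Data.List.Relation.Unary.AllPairs using ([]; _∷_)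

  Walk : VSet n → Fin n → Fin n → Set
  Walk = Reach Adj

  Connected : VSet n → Set
  Connected V = ∀ {x y} → V x → V y → Walk V x y

  vertices : ∀ {V x y} → Walk V x y → List (Fin n)
  vertices {x = x} here         = x ∷ []
  vertices {x = x} (step _ _ w) = x ∷ vertices w

  vertices-nonempty : ∀ {V x y} (w : Walk V x y) → 1 ≤ length (vertices w)
  vertices-nonempty here         = s≤s z≤n
  vertices-nonempty (step _ _ _) = s≤s z≤n

  vertices-All : ∀ {V x y} (w : Walk V x y) → V x → All V (vertices w)
  vertices-All here         vx = vx ∷ []
  vertices-All (step _ vy w) vx = vx ∷ vertices-All w vy

  Walk-mono : ∀ {V V′} → V ⊆ V′ → ∀ {x y} → Walk V x y → Walk V′ x y
  Walk-mono V⊆V′ here          = here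
  Walk-mono V⊆V′ (step e vy w) = step e (V⊆V′ vy) (Walk-mono V⊆V′ w)

  Walk-snoc : ∀ {V x y z} → Walk V x y → Adj y z → V z → Walk V x z
  Walk-snoc here          e vz = step e vz here
  Walk-snoc (step e′ vy w) e vz = step e′ vy (Walk-snoc w e vz)

  Walk-trans : ∀ {V x y z} → Walk V x y → Walk V y z → Walk V x z
  Walk-trans here          w′ = w′
  Walk-trans (step e vy w) w′ = step e vy (Walk-trans w w′)

  Walk-reverse : (∀ {x y} → Adj x y → Adj y x) → ∀ {V x y} → Walk V x y → V x → Walk V y x
  Walk-reverse sym here          vx = here
  Walk-reverse sym (step e vy w) vx = Walk-snoc (Walk-reverse sym w vy) (sym e) vx

  Walk-target : ∀ {V x y} → Walk V x y → V x → V y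
  Walk-target here          vx = vx
  Walk-target (step _ vy w) _  = Walk-target w vy

  Walk-restrict : ∀ {V Q : VSet n} {x y} → Walk V x y → (∀ {z} → V z → Walk V x z → Q z) →
                  Walk (λ z → V z × Q z) x y
  Walk-restrict here          q = here
  Walk-restrict (step e vy w) q = step e (vy , q vy (step e vy here))
                                    (Walk-restrict w (λ vz w′ → q vz (step e vy w′)))

  Walk-lastStep : ∀ {V x y} → Walk V x y → x ≢ y →
                  Σ (Fin n) λ p → Walk (λ z → V z × z ≢ y) x p × Adj p y
  Walk-lastStep here x≢y = contradiction refl x≢y
  Walk-lastStep {x = x} (step {y = z} {z = y} e vz w) x≢y with z ≟ y
  ... | yes refl = x , here , e
  ... | no z≢y with Walk-lastStep w z≢y
  ...   | p , w′ , e′ = p , step e (vz , z≢y) w′ , e′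

  Walk-firstEntry : ∀ {V P : VSet n} → Decidable P → ∀ {x y} → Walk V x y → ¬ P x → P y →
                    Σ (Fin n) λ p → Σ (Fin n) λ q →
                      ¬ P p × P q × Adj p q × V q × (p ≡ x ⊎ V p)
  Walk-firstEntry P? here ¬px py = contradiction py ¬px
  Walk-firstEntry P? {x = x} (step {y = z} e vz w) ¬px py with P? z
  ... | yes pz = x , z , ¬px , pz , e , vz , inj₁ refl
  ... | no ¬pz with Walk-firstEntry P? w ¬pz py
  ...   | p , q , ¬pp , pq , epq , vq , inj₁ refl = p , q , ¬pp , pq , epq , vq , inj₂ vz
  ...   | p , q , ¬pp , pq , epq , vq , inj₂ vp   = p , q , ¬pp , pq , epq , vq , inj₂ vp

  Walk-suffix : ∀ {V x y z} (w : Walk V y z) → x ∈ vertices w →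
                Σ (Walk V x z) λ s → Unique (vertices w) → Unique (vertices s)
  Walk-suffix here          (here refl) = here , λ w! → w!
  Walk-suffix (step e vy w) (here refl) = step e vy w , λ w! → w!
  Walk-suffix (step e vy w) (there x∈w) with Walk-suffix w x∈w
  ... | s , s! = s , λ { (_ ∷ w!) → s! w! }

  Walk-simple : ∀ {V x y} → Walk V x y → Σ (Walk V x y) λ w → Unique (vertices w)
  Walk-simple here = here , [] ∷ []
  Walk-simple {x = x} (step e vy w) with Walk-simple w
  ... | w′ , w′! with Any.any? (x ≟_) (vertices w′)
  ...   | yes x∈w′ = let s , s! = Walk-suffix w′ x∈w′ in s , s! w′!
  ...   | no x∉w′  = step e vy w′ , ¬Any⇒All¬ _ x∉w′ ∷ w′!

module SearchTrees {n : ℕ} (Adj : Graph n) where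
  open Walks Adj

  Depth-positive : ∀ {x : Fin n} {t d} → Depth x t d → 1 ≤ d
  Depth-positive root        = s≤s z≤n
  Depth-positive (child _ _) = s≤s z≤n

  Depth⇒∈T : ∀ {x : Fin n} {t d} → Depth x t d → x ∈T t
  Depth⇒∈T root            = root
  Depth⇒∈T (child c∈cs dx) = child c∈cs (Depth⇒∈T dx)

  ∈T⇒Depth : ∀ {x : Fin n} {t} → x ∈T t → ∃ (Depth x t)
  ∈T⇒Depth root = 1 , root
  ∈T⇒Depth (child c∈cs x∈c) = let d , dx = ∈T⇒Depth x∈c in suc d , child c∈cs dx

  Depth-child : ∀ {x v : Fin n} {cs d} → Depth x (node v cs) d → x ≢ v →
                Σ (RTree n) λ c → c ∈ cs × Σ ℕ λ d′ → d ≡ suc d′ × Depth x c d′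
  Depth-child root            x≢v = contradiction refl x≢v
  Depth-child (child c∈cs dx) _   = _ , c∈cs , _ , refl , dx

  IsComponent⇒⊆ : ∀ {V W : VSet n} → IsComponent Adj V W → W ⊆ V
  IsComponent⇒⊆ W-comp wy = proj₁ (Equivalence.to (proj₂ W-comp _ _ wy) wy)

  IsComponent-respˡ : ∀ {V V′ W : VSet n} → V ≐ V′ → IsComponent Adj V W → IsComponent Adj V′ W
  IsComponent-respˡ (V⊆V′ , V′⊆V) (ne , W-comp) = ne , λ x y wx → mk⇔
    (λ wy → let vy , w = Equivalence.to (W-comp x y wx) wy in V⊆V′ vy , Walk-mono V⊆V′ w)
    (λ (v′y , w) → Equivalence.from (W-comp x y wx) (V′⊆V v′y , Walk-mono V′⊆V w))

  IsComponent-respʳ : ∀ {V W W′ : VSet n} → W ≐ W′ → IsComponent Adj V W → IsComponent Adj V W′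
  IsComponent-respʳ (W⊆W′ , W′⊆W) ((x , wx) , W-comp) = (x , W⊆W′ wx) , λ y z w′y → mk⇔
    (λ w′z → Equivalence.to (W-comp y z (W′⊆W w′y)) (W′⊆W w′z))
    (λ vz → W⊆W′ (Equivalence.from (W-comp y z (W′⊆W w′y)) vz))

  IsSTTOn⇒⊆ : ∀ {U : VSet n} {t} → IsSTTOn Adj U t → VT t ⊆ U
  IsSTTOn⇒⊆ (mk ur _ _ _ _)       root            = ur
  IsSTTOn⇒⊆ (mk _ _ components _ _) (child c∈cs x∈c) = proj₁ (IsComponent⇒⊆ (components _ c∈cs) x∈c)

  IsSTTOn⇒⊇ : ∀ {U : VSet n} {t} → IsSTTOn Adj U t → U ⊆ VT t
  IsSTTOn⇒⊇ (mk {r = r} _ _ _ covered _) {x} ux with x ≟ r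
  ... | yes refl = root
  ... | no x≢r   = let _ , c∈cs , x∈c = covered x ux x≢r in child c∈cs x∈c

  IsSTTOn-resp : ∀ {U U′ : VSet n} {t} → U ≐ U′ → IsSTTOn Adj U t → IsSTTOn Adj U′ t
  IsSTTOn-resp (U⊆U′ , U′⊆U) (mk ur disjoint components covered subtrees) =
    mk (U⊆U′ ur) disjoint
       (λ c c∈cs → IsComponent-respˡ ((λ (ux , x≢r) → U⊆U′ ux , x≢r) ,
                                       (λ (u′x , x≢r) → U′⊆U u′x , x≢r))
                                      (components c c∈cs))
       (λ x u′x x≢r → covered x (U′⊆U u′x) x≢r) subtrees

  child-unique : ∀ {U : VSet n} {r cs c c′ x} → IsSTTOn Adj U (node r cs) → c ∈ cs → c′ ∈ cs →
                 x ∈T c → x ∈T c′ → c ≡ c′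
  child-unique {cs = cs} (mk _ disjoint _ _ _) c∈cs c′∈cs x∈c x∈c′ =
    let c≡ = lookup-index c∈cs
        c′≡ = lookup-index c′∈cs
        i≡j = disjoint (Any.index c∈cs) (Any.index c′∈cs) _
                       (subst (_ ∈T_) c≡ x∈c) (subst (_ ∈T_) c′≡ x∈c′)
    in trans c≡ (trans (cong (lookup cs) i≡j) (sym c′≡))

  IsShallowest : RTree n → VSet n → Fin n → Set
  IsShallowest t W r = W r × (∀ {x dr dx} → W x → x ≢ r → Depth r t dr → Depth x t dx → dr < dx)

  shallowest : ∀ {U W : VSet n} {t} → IsSTTOn Adj U t → Decidable W → W ⊆ U → Connected W → ∃ W →
               ∃ (IsShallowest t W)
  shallowest {W = W} t-stt@(mk {r = v} {cs} _ _ components covered subtrees) W? W⊆U W-conn (w₀ , ww₀)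
    with W? v
  ... | yes wv = v , wv , root-shallowest
    where
    root-shallowest : ∀ {x dr dx} → W x → x ≢ v → Depth v (node v cs) dr → Depth x (node v cs) dx → dr < dx
    root-shallowest _ x≢v root dx with Depth-child dx x≢v
    ... | _ , _ , _ , refl , dx′ = s≤s (Depth-positive dx′)
    root-shallowest _ _ (child c∈cs dv) _ =
      contradiction refl (proj₂ (IsComponent⇒⊆ (components _ c∈cs) (Depth⇒∈T dv)))
  ... | no ¬wv = r , wr , child-shallowest
    where
    W∌v : ∀ {z} → W z → z ≢ v
    W∌v wz refl = ¬wv wz

    c₀ : Σ (RTree n) λ c → c ∈ cs × w₀ ∈T c
    c₀ = covered w₀ (W⊆U ww₀) (W∌v ww₀)

    W⊆c₀ : W ⊆ VT (proj₁ c₀)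
    W⊆c₀ wy = Equivalence.from (proj₂ (components _ (proj₁ (proj₂ c₀))) _ _ (proj₂ (proj₂ c₀)))
                ((W⊆U wy , W∌v wy) , Walk-mono (λ wz → W⊆U wz , W∌v wz) (W-conn ww₀ wy))

    in-c₀ : ∃ (IsShallowest (proj₁ c₀) W)
    in-c₀ = shallowest (subtrees _ (proj₁ (proj₂ c₀))) W? W⊆c₀ W-conn (w₀ , ww₀)

    r = proj₁ in-c₀
    wr = proj₁ (proj₂ in-c₀)

    child-shallowest : ∀ {x dr dx} → W x → x ≢ r → Depth r (node v cs) dr → Depth x (node v cs) dx → dr < dx
    child-shallowest wx x≢r dr dx with Depth-child dr (W∌v wr) | Depth-child dx (W∌v wx)
    ... | c , c∈cs , _ , refl , dr′ | c′ , c′∈cs , _ , refl , dx′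
      with child-unique t-stt c∈cs (proj₁ (proj₂ c₀)) (Depth⇒∈T dr′) (W⊆c₀ wr)
         | child-unique t-stt c′∈cs (proj₁ (proj₂ c₀)) (Depth⇒∈T dx′) (W⊆c₀ wx)
    ... | refl | refl = s≤s (proj₂ (proj₂ in-c₀) wx x≢r dr′ dx′)

module InTree {n : ℕ} {Adj : Graph n} (tree : IsTree Adj) where
  open IsTree tree renaming (sym to Adj-sym)
  open Walks Adj
  open import Data.List.Relation.Unary.AllPairs using (_∷_)
  open import Data.List.Relation.Unary.Linked using ([-]; _∷_)

  private
    Linked-snoc : ∀ {V u y v} (w : Walk V u y) → Adj y v → Linked Adj (vertices w ++ [ v ])
    Linked-snoc here                       e = e ∷ [-]
    Linked-snoc (step e′ _ here)           e = e′ ∷ e ∷ [-]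
    Linked-snoc (step e′ _ w@(step _ _ _)) e = e′ ∷ Linked-snoc w e

  close-cycle : ∀ {V v u z y} (uz : Adj u z) (vz : V z) (w : Walk V z y) →
                Adj v u → Adj y v → Unique (v ∷ vertices (step uz vz w)) → Cycle Adj
  close-cycle uz vz w vu yv v∷w! =
    _ , vertices (step uz vz w) , s≤s (vertices-nonempty w) , v∷w! , vu ∷ Linked-snoc (step uz vz w) yv

  -- x and y are adjacent iff the simple walk joining them has exactly two vertices
  adjacent? : ∀ x y → Dec (Adj x y)
  adjacent? x y with Walk-simple (connected x y)
  ... | here , _ = no irrefl
  ... | step xy _ here , _ = yes xy
  ... | step xz _ (step zz′ vz′ w) , x∷w! = no λ xy → acyclic (close-cycle zz′ vz′ w xz (Adj-sym xy) x∷w!)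

  outside-neighbour-unique : ∀ {V : VSet n} {b u w} → Connected V → ¬ V b →
                             Adj b u → Adj b w → V u → V w → u ≡ w
  outside-neighbour-unique {V} {b} {u} {w} V-conn ¬vb bu bw vu vw with u ≟ w
  ... | yes u≡w = u≡w
  ... | no u≢w with Walk-simple (V-conn vu vw)
  ...   | here , _ = contradiction refl u≢w
  ...   | p@(step e vz p′) , p! = contradiction (close-cycle e vz p′ bu (Adj-sym bw) (b∉p ∷ p!)) acyclic
    where
    b∉p : All (b ≢_) (vertices p)
    b∉p = All.map (λ vz b≡z → ¬vb (subst V (sym b≡z) vz)) (vertices-All p vu)

  module _ {V : VSet n} (V? : Decidable V) where
    private
      short-walk? : ∀ N x y → Dec (Σ (Walk V x y) λ w → length (vertices w) ≤ suc N)
      short-walk? N x y with x ≟ y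
      ... | yes refl = yes (here , s≤s z≤n)
      short-walk? zero x y | no x≢y =
        no λ { (here , _) → x≢y refl ; (step _ _ here , s≤s ()) ; (step _ _ (step _ _ _) , s≤s ()) }
      short-walk? (suc N) x y | no x≢y with any? (λ z → adjacent? x z ×-dec V? z ×-dec short-walk? N z y)
      ...   | yes (_ , xz , vz , w , |w|≤) = yes (step xz vz w , s≤s |w|≤)
      ...   | no none = no λ { (here , _) → x≢y refl
                             ; (step xz vz w , s≤s |w|≤) → none (_ , xz , vz , w , |w|≤) }

    -- a simple walk has at most n vertices, so a bounded search suffices
    reachable? : ∀ x y → Dec (Walk V x y)
    reachable? x y with short-walk? n x y
    ... | yes (w , _) = yes w
    ... | no none = no λ w → let w′ , w′! = Walk-simple w
                             in none (w′ , ℕ.m≤n⇒m≤1+n (Unique⇒length≤ w′!))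

  OuterBoundary : VSet n → VSet n → VSet n
  OuterBoundary U W b = ¬ U b × ∃ λ w → W w × Adj w b

  outerBoundary? : ∀ {U W : VSet n} → Decidable U → Decidable W → Decidable (OuterBoundary U W)
  outerBoundary? U? W? b = ¬? (U? b) ×-dec any? (λ w → W? w ×-dec adjacent? w b)

  module Components {U : VSet n} (U? : Decidable U) (v : Fin n) where

    Punctured : VSet n
    Punctured z = U z × z ≢ v

    punctured? : Decidable Punctured
    punctured? z = U? z ×-dec ¬? (z ≟ v)

    Component : Fin n → VSet n
    Component x y = Punctured x × Punctured y × Walk Punctured x y

    component? : ∀ x → Decidable (Component x)
    component? x y = punctured? x ×-dec punctured? y ×-dec reachable? punctured? x y

    component⊆U : ∀ {x} → Component x ⊆ U
    component⊆U (_ , (uy , _) , _) = uy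

    component-refl : ∀ {x} → Punctured x → Component x x
    component-refl px = px , px , here

    component-sym : ∀ {x y} → Component x y → Component y x
    component-sym (px , py , w) = py , px , Walk-reverse Adj-sym w px

    component-trans : ∀ {x y z} → Component x y → Component y z → Component x z
    component-trans (px , _ , w) (_ , pz , w′) = px , pz , Walk-trans w w′

    component-extend : ∀ {x y z} → Component x y → Punctured z → Adj y z → Component x z
    component-extend (px , _ , w) pz yz = px , pz , Walk-snoc w yz pz

    component-connected : ∀ x → Connected (Component x)
    component-connected x x~y x~z =
      Walk-mono proj₂ (Walk-restrict (proj₂ (proj₂ (component-trans (component-sym x~y) x~z)))
                                     (λ pz′ w → component-trans x~y (proj₁ (proj₂ x~y) , pz′ , w)))

    component-isComponent : ∀ {x} → Punctured x → IsComponent Adj Punctured (Component x)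
    component-isComponent {x} px = (x , component-refl px) , λ y z x~y → mk⇔
      (λ x~z → proj₁ (proj₂ x~z) , proj₂ (proj₂ (component-trans (component-sym x~y) x~z)))
      (λ (pz , w) → component-trans x~y (proj₁ (proj₂ x~y) , pz , w))

    component-smaller : U v → ∀ x → count (component? x) (allFin n) < count U? (allFin n)
    component-smaller uv x = count-< (component? x) U? component⊆U (allFin n) (∈-allFin v) uv
                                     (λ x~v → proj₂ (proj₁ (proj₂ x~v)) refl)

    component-boundary : ∀ {L} → Boundary Adj U ⊆ (_∈ L) → ∀ x →
                         Boundary Adj (Component x) ⊆ (_∈ v ∷ filter (outerBoundary? U? (component? x)) L)
    component-boundary δU⊆L x {y} (y∉X , z , x~z , zy) with y ≟ v
    ... | yes refl = here refl
    ... | no y≢v with U? y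
    ...   | yes uy = contradiction (component-extend x~z (uy , y≢v) zy) y∉X
    ...   | no ¬uy = there (∈-filter⁺ (outerBoundary? U? (component? x))
                                      (δU⊆L (¬uy , z , component⊆U x~z , zy)) (¬uy , z , x~z , zy))

    IsRepresentative : VSet n
    IsRepresentative x = Punctured x × (∀ z → z Fin.< x → ¬ Component x z)

    isRepresentative? : Decidable IsRepresentative
    isRepresentative? x = punctured? x ×-dec all? (λ z → (z <? x) →-dec ¬? (component? x z))

    representatives : List (Fin n)
    representatives = filter isRepresentative? (allFin n)

    representatives-unique : Unique representatives
    representatives-unique = Unique.filter⁺ isRepresentative? (Unique.allFin⁺ n)

    representatives-All : All IsRepresentative representatives
    representatives-All = all-filter isRepresentative? (allFin n)

    representative-exists : ∀ {y} → Punctured y → Σ (Fin n) λ x → x ∈ representatives × Component x y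
    representative-exists py with minimal (component? _) (component-refl py)
    ... | x , y~x , x-least =
      x , ∈-filter⁺ isRepresentative? (∈-allFin x)
            (proj₁ (proj₂ y~x) , λ z z<x x~z → ℕ.<⇒≱ z<x (x-least (component-trans y~x x~z))) ,
          component-sym y~x

    representative-unique : ∀ {x x′ y} → IsRepresentative x → IsRepresentative x′ →
                            Component x y → Component x′ y → x ≡ x′
    representative-unique {x} {x′} (_ , x-least) (_ , x′-least) x~y x′~y with <-cmp x x′
    ... | tri< x<x′ _ _ = contradiction (component-trans x′~y (component-sym x~y)) (x′-least x x<x′)
    ... | tri≈ _ x≡x′ _ = x≡x′
    ... | tri> _ _ x′<x = contradiction (component-trans x~y (component-sym x′~y)) (x-least x′ x′<x)

  module Separator {U : VSet n} (U? : Decidable U) (U-connected : Connected U)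
                   {r : Fin n} (ur : U r) (L : List (Fin n)) (m : ℕ) where
    open Components U?

    weight : Fin n → Fin n → ℕ
    weight c x = count (outerBoundary? U? (component? c x)) L

    Balanced : Fin n → Set
    Balanced c = ∀ {x} → Punctured c x →
                   (Component c x r → weight c x + suc m ≤ length L) ×
                   (¬ Component c x r → weight c x ≤ m)

    Away : Fin n → VSet n
    Away c y = U y × y ≢ c × ¬ Component c r y

    away? : ∀ c → Decidable (Away c)
    away? c y = U? y ×-dec ¬? (y ≟ c) ×-dec ¬? (component? c r y)

    awayCount : Fin n → ℕ
    awayCount c = count (away? c) (allFin n)

    module Move {c x p : Fin n} (uc : U c) (x≁r : ¬ Component c x r) (x~p : Component c x p)
                (cp : Adj c p) where

      p≢c : p ≢ c
      p≢c = proj₂ (proj₁ (proj₂ x~p))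

      r≢p : r ≢ p
      r≢p refl = x≁r x~p

      -- The first edge of r⇝u entering the component of x starts either at c, and is then the
      -- edge cp by outside-neighbour-unique, or in U ∖ c, whose vertex then joins the component.
      components-disjoint : ∀ {u} → Component p r u → ¬ Component c x u
      components-disjoint (_ , _ , r⇝u) x~u with Walk-firstEntry (component? c x) r⇝u x≁r x~u
      ... | q , q′ , x≁q , x~q′ , qq′ , (_ , q′≢p) , q-origin with q ≟ c
      ...   | yes refl = q′≢p (outside-neighbour-unique (component-connected c x)
                                 (λ x~c → proj₂ (proj₁ (proj₂ x~c)) refl) qq′ cp x~q′ x~p)
      ...   | no q≢c = x≁q (component-extend c x~q′ (q∈U q-origin , q≢c) (Adj-sym qq′))
        where
        q∈U : q ≡ r ⊎ Punctured p q → U q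
        q∈U (inj₁ refl)    = ur
        q∈U (inj₂ (uq , _)) = uq

      weights-disjoint : weight p r + weight c x ≤ length L
      weights-disjoint = count-disjoint (outerBoundary? U? (component? p r))
                                        (outerBoundary? U? (component? c x)) disjoint L
        where
        disjoint : ∀ {b} → OuterBoundary U (Component p r) b → ¬ OuterBoundary U (Component c x) b
        disjoint (¬ub , u , r~u , ub) (_ , w , x~w , wb) =
          components-disjoint r~u (subst (Component c x) (sym u≡w) x~w)
          where
          u≡w = outside-neighbour-unique U-connected ¬ub (Adj-sym ub) (Adj-sym wb)
                  (component⊆U p r~u) (component⊆U c x~w)

      Away-shrinks : Away p ⊆ Away c
      Away-shrinks {y} (uy , y≢p , r≁y) =
        uy , y≢c , λ (cr , _ , w) → r≁y ((ur , r≢p) , (uy , y≢p) , avoid-p cr w)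
        where
        pc : Punctured p c
        pc = uc , λ c≡p → p≢c (sym c≡p)

        -- p lies in the component of x, which r does not reach
        avoid-p : Punctured c r → ∀ {z} → Walk (Punctured c) r z → Walk (Punctured p) r z
        avoid-p cr w = Walk-mono (λ (cz , z≢p) → proj₁ cz , z≢p) (Walk-restrict w p-unreached)
          where
          p-unreached : ∀ {z} → Punctured c z → Walk (Punctured c) r z → z ≢ p
          p-unreached cz w′ refl = x≁r (component-trans c x~p (component-sym c (cr , cz , w′)))

        y≢c : y ≢ c
        y≢c refl with r ≟ c
        ... | yes refl = r≁y ((ur , r≢p) , pc , here)
        ... | no r≢c with Walk-lastStep (U-connected ur uc) r≢c
        ...   | q , r⇝q , qc = r≁y ((ur , r≢p) , pc , Walk-snoc (avoid-p (ur , r≢c) r⇝q) qc pc)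

      awayCount-< : awayCount p < awayCount c
      awayCount-< = count-< (away? p) (away? c) Away-shrinks (allFin n) (∈-allFin p)
                      (proj₁ (proj₁ (proj₂ x~p)) , p≢c ,
                       λ r~p → x≁r (component-trans c x~p (component-sym c r~p)))
                      (λ (_ , p≢p , _) → p≢p refl)

    -- Step from c towards a component away from r that sees more than m vertices of L. Its outer
    -- boundary is disjoint from that of r's component at the new c, so r's side stays light.
    separate : ∀ c → U c → Acc _<_ (awayCount c) → weight c r + suc m ≤ length L →
               Σ (Fin n) λ c → U c × Balanced c
    separate c uc (acc smaller) r-heavy
      with any? (λ x → punctured? c x ×-dec ¬? (component? c x r) ×-dec (m ℕ.<? weight c x))
    ... | no none = c , uc , λ cx → r-side , λ x≁r → ℕ.≮⇒≥ (λ heavy → none (_ , cx , x≁r , heavy))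
      where
      r-side : ∀ {x} → Component c x r → weight c x + suc m ≤ length L
      r-side x~r = ℕ.≤-trans (ℕ.+-monoˡ-≤ (suc m) (count-mono _ _ x⊆r L)) r-heavy
        where
        x⊆r : OuterBoundary U (Component c _) ⊆ OuterBoundary U (Component c r)
        x⊆r (¬ub , w , x~w , wb) = ¬ub , w , component-trans c (component-sym c x~r) x~w , wb
    ... | yes (x , cx , x≁r , x-heavy) with Walk-lastStep (U-connected (proj₁ cx) uc) (proj₂ cx)
    ...   | p , x⇝p , pc =
            separate p (component⊆U c x~p) (smaller awayCount-<)
                     (ℕ.≤-trans (ℕ.+-monoʳ-≤ (weight p r) x-heavy) weights-disjoint)
      where
      x~p : Component c x p
      x~p = cx , Walk-target x⇝p cx , x⇝p
      open Move uc x≁r x~p (Adj-sym pc)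

    separator : suc m ≤ length L → Σ (Fin n) λ c → U c × Balanced c
    separator m<|L| = separate r ur (<-wellFounded _) (subst (λ w → w + suc m ≤ length L) (sym weight-r-r) m<|L|)
      where
      weight-r-r : weight r r ≡ 0
      weight-r-r = cong length (filter-none (outerBoundary? U? (component? r r))
                                  (All.universal (λ _ (_ , _ , r~w , _) → proj₂ (proj₁ r~w) refl) L))

module Construction {n : ℕ} {Adj : Graph n} (tree : IsTree Adj)
                    (T : RTree n) (T-stt : IsSTT Adj T) (k m : ℕ) (m<k : m < k) where
  open Walks Adj
  open SearchTrees Adj
  open InTree tree

  DepthBound : ℕ → RTree n → Set
  DepthBound D t = ∀ {x d d*} → Depth x T d → Depth x t d* → m * (D + d*) ≤ (m + 1) * d

  Result : VSet n → ℕ → Set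
  Result U D = Σ (RTree n) λ t → IsSTTOn Adj U t × IsKCut Adj k t × DepthBound D t

  module Assemble {U : VSet n} (U? : Decidable U) {v : Fin n} (uv : U v) (D : ℕ) where
    open Components U? v
    open import Data.List.Relation.Unary.All using ([]; _∷_)
    open import Data.List.Relation.Unary.AllPairs using (_∷_)

    ChildResult : Fin n → Set
    ChildResult x = Result (Component x) (suc D)

    subtrees : ∀ {xs} → All ChildResult xs → List (RTree n)
    subtrees []         = []
    subtrees (res ∷ rs) = proj₁ res ∷ subtrees rs

    subtree-result : ∀ {xs c} (rs : All ChildResult xs) → c ∈ subtrees rs →
                     Σ (Fin n) λ x → x ∈ xs × IsSTTOn Adj (Component x) c × IsKCut Adj k c × DepthBound (suc D) c
    subtree-result (r ∷ _)  (here refl) = _ , here refl , proj₂ r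
    subtree-result (_ ∷ rs) (there c∈) = let x , x∈ , res = subtree-result rs c∈ in x , there x∈ , res

    subtree-of : ∀ {xs x} (rs : All ChildResult xs) → x ∈ xs →
                 Σ (RTree n) λ c → c ∈ subtrees rs × IsSTTOn Adj (Component x) c
    subtree-of (r ∷ _)  (here refl) = proj₁ r , here refl , proj₁ (proj₂ r)
    subtree-of (_ ∷ rs) (there x∈)  = let c , c∈ , c-stt = subtree-of rs x∈ in c , there c∈ , c-stt

    lookup-subtree : ∀ {xs} (rs : All ChildResult xs) i {y} → y ∈T lookup (subtrees rs) i →
                     Σ (Fin n) λ x → x ∈ xs × Component x y
    lookup-subtree (r ∷ _)  Fin.zero    y∈ = _ , here refl , IsSTTOn⇒⊆ (proj₁ (proj₂ r)) y∈
    lookup-subtree (_ ∷ rs) (Fin.suc i) y∈ = let x , x∈ , x~y = lookup-subtree rs i y∈ in x , there x∈ , x~y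

    subtrees-disjoint : ∀ {xs} → Unique xs → All IsRepresentative xs → (rs : All ChildResult xs) →
                        ∀ i j y → y ∈T lookup (subtrees rs) i → y ∈T lookup (subtrees rs) j → i ≡ j
    subtrees-disjoint _ _ (_ ∷ _) Fin.zero Fin.zero _ _ _ = refl
    subtrees-disjoint (x∉xs ∷ _) (x-rep ∷ reps) (r ∷ rs) Fin.zero (Fin.suc j) y y∈ y∈′ =
      let x′ , x′∈ , x′~y = lookup-subtree rs j y∈′
      in contradiction (representative-unique x-rep (All.lookup reps x′∈)
                                               (IsSTTOn⇒⊆ (proj₁ (proj₂ r)) y∈) x′~y)
                       (All.lookup x∉xs x′∈)
    subtrees-disjoint (x∉xs ∷ _) (x-rep ∷ reps) (r ∷ rs) (Fin.suc i) Fin.zero y y∈ y∈′ =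
      let x′ , x′∈ , x′~y = lookup-subtree rs i y∈
      in contradiction (representative-unique x-rep (All.lookup reps x′∈)
                                               (IsSTTOn⇒⊆ (proj₁ (proj₂ r)) y∈′) x′~y)
                       (All.lookup x∉xs x′∈)
    subtrees-disjoint (_ ∷ xs!) (_ ∷ reps) (_ ∷ rs) (Fin.suc i) (Fin.suc j) y y∈ y∈′ =
      cong Fin.suc (subtrees-disjoint xs! reps rs i j y y∈ y∈′)

    assemble : (L : List (Fin n)) → length L ≤ k → Boundary Adj U ⊆ (_∈ L) →
               (∀ {d} → Depth v T d → m * (D + 1) ≤ (m + 1) * d) →
               (∀ {x} → IsRepresentative x → ChildResult x) → Result U D
    assemble L |L|≤k δU⊆L root-bound result-for = t , t-stt , t-kcut , t-depth
      where
      rs = All.map result-for representatives-All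
      t = node v (subtrees rs)

      t-stt : IsSTTOn Adj U t
      t-stt = mk uv (subtrees-disjoint representatives-unique representatives-All rs)
                 (λ c c∈ → let x , x∈ , c-stt , _ = subtree-result rs c∈
                           in IsComponent-respʳ (IsSTTOn⇒⊇ c-stt , IsSTTOn⇒⊆ c-stt)
                                                (component-isComponent (proj₁ (All.lookup representatives-All x∈))))
                 (λ y uy y≢v → let x , x∈ , x~y = representative-exists (uy , y≢v)
                                   c , c∈ , c-stt = subtree-of rs x∈
                               in c , c∈ , IsSTTOn⇒⊇ c-stt x~y)
                 (λ c c∈ → let _ , _ , c-stt , _ = subtree-result rs c∈
                           in IsSTTOn-resp (IsSTTOn⇒⊇ c-stt , IsSTTOn⇒⊆ c-stt) c-stt)

      t-kcut : IsKCut Adj k t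
      t-kcut _ self = L , |L|≤k , λ y (y∉t , z , z∈t , zy) →
        δU⊆L ((λ uy → y∉t (IsSTTOn⇒⊇ t-stt uy)) , z , IsSTTOn⇒⊆ t-stt z∈t , zy)
      t-kcut t′ (child c∈ t′⊑c) = let _ , _ , _ , c-kcut , _ = subtree-result rs c∈ in c-kcut t′ t′⊑c

      t-depth : DepthBound D t
      t-depth dx root = root-bound dx
      t-depth {d = d} dx (child {d = d′} c∈ dx′) =
        let _ , _ , _ , _ , c-depth = subtree-result rs c∈
        in subst (λ e → m * e ≤ (m + 1) * d) (sym (ℕ.+-suc D d′)) (c-depth dx dx′)

  build : ∀ {U} (U? : Decidable U) → Acc _<_ (count U? (allFin n)) → Connected U → ∃ U →
          (L : List (Fin n)) → length L ≤ k → Boundary Adj U ⊆ (_∈ L) →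
          ∀ D a → Invariant m D (length L) a → (∀ {x d} → U x → Depth x T d → a < d) →
          Result U D
  build {U} U? (acc smaller) U-conn U≠∅ L |L|≤k δU⊆L D a inv deeper = choose-root (length L ℕ.<? k)
    where
    open Components U?

    top : ∃ (IsShallowest T U)
    top = shallowest T-stt U? (λ _ → tt) U-conn U≠∅

    r = proj₁ top
    ur = proj₁ (proj₂ top)
    open Separator U? U-conn ur L m
    r-depth : ∃ (Depth r T)
    r-depth = ∈T⇒Depth (IsSTTOn⇒⊇ T-stt tt)

    dr = proj₁ r-depth

    a<dr : a < dr
    a<dr = deeper ur (proj₂ r-depth)

    below-r : ∀ {y d} → U y → y ≢ r → Depth y T d → dr < d
    below-r uy y≢r = proj₂ (proj₂ top) uy y≢r (proj₂ r-depth)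

    root-bound : ∀ {v d} → U v → Depth v T d → m * (D + 1) ≤ (m + 1) * d
    root-bound uv dv = Invariant-root inv (deeper uv dv)

    descend : ∀ {c} → U c → ∀ {x} → Punctured c x → (a′ : ℕ) → suc (weight c x) ≤ k →
              Invariant m (suc D) (suc (weight c x)) a′ →
              (∀ {y d} → Component c x y → Depth y T d → a′ < d) →
              Result (Component c x) (suc D)
    descend {c} uc {x} cx a′ |Lₓ|≤k inv′ deeper′ =
      build (component? c x) (smaller (component-smaller c uc x)) (component-connected c x)
            (x , component-refl c cx) (c ∷ filter (outerBoundary? U? (component? c x)) L) |Lₓ|≤k
            (component-boundary c δU⊆L x) (suc D) a′ inv′ deeper′

    choose-root : Dec (length L < k) → Result U D
    choose-root (yes |L|<k) = Assemble.assemble U? ur D L |L|≤k δU⊆L (root-bound ur) λ (rx , _) →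
      descend ur rx dr (ℕ.≤-<-trans (length-filter _ L) |L|<k)
            (Invariant-descend inv (length-filter _ L) a<dr)
            (λ (_ , (uy , y≢r) , _) → below-r uy y≢r)
    choose-root (no |L|≮k) = Assemble.assemble U? uc D L |L|≤k δU⊆L (root-bound uc) λ (cx , _) →
      from-separator cx (component? c _ r)
      where
      m<|L| : m < length L
      m<|L| = ℕ.≤-trans m<k (ℕ.≮⇒≥ |L|≮k)

      c = proj₁ (separator m<|L|)
      uc = proj₁ (proj₂ (separator m<|L|))
      balanced = proj₂ (proj₂ (separator m<|L|))

      from-separator : ∀ {x} → Punctured c x → Dec (Component c x r) → Result (Component c x) (suc D)
      from-separator cx (yes x~r) =
        let x-heavy = proj₁ (balanced cx) x~r
        in descend uc cx a (ℕ.≤-trans (ℕ.≤-trans (ℕ.m<m+n _ z<s) x-heavy) |L|≤k)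
                 (Invariant-shrink inv x-heavy)
                 (λ x~y → deeper (component⊆U c x~y))
      from-separator cx (no x≁r) =
        let x-light = proj₂ (balanced cx) x≁r
        in descend uc cx dr (ℕ.≤-<-trans x-light m<k)
                 (Invariant-descend inv (ℕ.≤-trans x-light (ℕ.<⇒≤ m<|L|)) a<dr)
                 (λ x~y@(_ , (uy , _) , _) → below-r uy (λ { refl → x≁r x~y }))

lemma19 : ∀ {n : ℕ} (Adj : Graph n) → IsTree Adj →
    (T : RTree n) → IsSTT Adj T →
    (k : ℕ) → 2 ≤ k →
    Σ (RTree n) λ T* → IsSTT Adj T* × IsKCut Adj k T* ×
    (∀ (x : Fin n) (d d* : ℕ) → Depth x T d → Depth x T* d* →
    (k / 2) * d* ≤ (k / 2 + 1) * d)
lemma19 Adj tree T T-stt zero ()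
lemma19 Adj tree T@(node r₀ _) T-stt k@(suc _) _ =
  let T* , T*-stt , T*-kcut , T*-depth =
        build (λ _ → yes tt) (<-wellFounded _) (λ {x} {y} _ _ → connected x y) (r₀ , tt)
              [] z≤n (λ (¬⊤ , _) → contradiction tt ¬⊤) 0 0 (Invariant-start (k / 2)) (λ _ → Depth-positive)
  in T* , T*-stt , T*-kcut , λ _ _ _ → T*-depth
  where
  open IsTree tree using (connected)
  open SearchTrees Adj using (Depth-positive)
  open Construction tree T T-stt k (k / 2) (m/n<m k 2 (s≤s (s≤s z≤n)))
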